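{- Let $t>2$ be an integer, $q=2$ and $p = 2^t + 2^{t-2} - 2$. Then there exists $k_0$ such that $C_{p,q}$ is a submatrix of $A_{k,t}$ for every $k\ge k_0$.
   Context: For positive integers $k,t$ with $k\ge t$, $A_{k,t}$ is the $0,1$-matrix of size $\binom{k}{t}\times\binom{k}{t}$ whose rows and columns are indexed by all $t$-element subsets of $[k]=\{1,\dots,k\}$, with entry $1$ in row $x$, column $y$ if and only if $x\cap y\neq\emptyset$. For integers $p\ge 1$, $q\ge 0$ and $n=p+q$, $C_{p,q}$ is the $n\times n$ circulant $0,1$-matrix whose entry in row $i$, column $j$ ($1\le i,j\le n$) is $1$ iff $(i-j) \bmod n \in\{0,1,\dots,p-1\}$. An $n\times m$ $0,1$-matrix $M$ is a submatrix of $A_{k,t}$ if there are distinct $t$-subsets $F_1,\dots,F_n$ of $[k]$ and distinct $t$-subsets $G_1,\dots,G_m$ of $[k]$ with $M_{ij}=1$ iff $F_i\cap G_j\ne\emptyset$. -}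

module Defs where

open import Data.Nat using (ℕ; zero; suc; _+_; _∸_; _<_; _<ᵇ_; _^_; NonZero)
open import Data.Nat.DivMod using (_%_)
open import Data.Bool using (Bool; true)
open import Data.Fin using (Fin; toℕ)
open import Data.Fin.Subset using (Subset; _∈_; ∣_∣)
open import Data.Product using (Σ; ∃; _×_)
open import Function.Definitions using (Injective)
open import Relation.Binary.PropositionalEquality using (_≡_)
open import Function.Bundles using (_⇔_)

-- Rows/columns indexed 0..n-1 instead of 1..n; (i - j) mod n is unaffected by the shift.
-- C p q : the (p+q)×(p+q) circulant 0,1-matrix, entry (i,j) is true iff (i - j) mod n < p.
-- residue a mod n (n = 0 never occurs since Fin 0 is empty; returns a then).
modN : ℕ → ℕ → ℕ
modN a zero = a
modN a (suc n) = a % suc n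

C : (p q : ℕ) → Fin (p + q) → Fin (p + q) → Bool
C p q i j = modN ((toℕ i + (p + q)) ∸ toℕ j) (p + q) <ᵇ p

IsTSubset : (k t : ℕ) → Subset k → Set
IsTSubset k t F = ∣ F ∣ ≡ t

Meets : {k : ℕ} → Subset k → Subset k → Set
Meets {k} x y = ∃ λ (i : Fin k) → (i ∈ x) × (i ∈ y)

IsSubmatrixOfA : (k t : ℕ) {n m : ℕ} → (Fin n → Fin m → Bool) → Set
IsSubmatrixOfA k t {n} {m} M =
  Σ (Fin n → Subset k) λ F → Σ (Fin m → Subset k) λ G →
    Injective _≡_ _≡_ F × Injective _≡_ _≡_ G ×
    (∀ i → IsTSubset k t (F i)) × (∀ j → IsTSubset k t (G j)) ×
    (∀ i j → (M i j ≡ true) ⇔ Meets (F i) (G j))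

module Submission where

-- With n = p + 2 and column j relabelled as e = j - 2 (mod n), the two zeros of row x of
-- C_{p,2} sit at e = x and e = x - 1.  So it suffices to find t-subsets R x (rows) and E e
-- (columns) of [k] with R x ∩ E e = ∅ exactly when e ∈ {x, x - 1} (mod n).  Such data, with
-- two extra (t+1)-sets marking the two ends of the cycle, is a `CycleSystem n k t`.
--   * `widen`: a cycle system over [k] is one over every [k'] with k ≤ k'.
--   * `double`: a cycle system of length n over [k] with t-sets yields one of length 2n
--     over [k+2] with (t+1)-sets; the second copy runs backwards, two new points separate
--     the copies and the end markers close the two seams.
--   * `cycleSystem₅`: the 5-cycle over [5] with 2-sets, verified by computation; doubling it
--     s times gives a system of length 5·2^s = 2^(s+2) + 2^s with (s+2)-sets.
--   * `circulant-submatrix`: a cycle system of length n ≥ 3 realises C_{n-2,2}.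
-- For t = s + 2 these give the theorem, with k₀ the ground set size of stage s.

open import Defs
open import Data.Nat using (ℕ; zero; suc; _+_; _*_; _∸_; _^_; _<_; _≤_; _≥_; z≤n; s≤s; _<ᵇ_)
open import Data.Nat.Properties
open import Data.Nat.DivMod using (_%_; [m+n]%n≡m%n; m<n⇒m%n≡m)
open import Data.Nat.Tactic.RingSolver using (solve-∀)
open import Data.Bool using (Bool; true; false; _∧_; _∨_; if_then_else_)
import Data.Bool.Properties as Bool
open import Data.Vec using ([]; _∷_)
open import Data.Fin using (Fin; toℕ) renaming (zero to fzero; suc to fsuc)
open import Data.Fin.Properties using (toℕ<n; toℕ-injective)
open import Data.Fin.Subset using (Subset; ∣_∣) renaming (⊥ to ∅)
open import Data.Vec.Base using (here; there)
open import Data.Product using (∃; _×_; _,_)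
open import Data.Sum using (_⊎_; inj₁; inj₂)
open import Data.Empty using (⊥-elim)
open import Relation.Nullary using (¬_; Dec; yes; no; contradiction)
open import Relation.Nullary.Reflects using (Reflects; ofʸ; ofⁿ)
open import Relation.Binary.Definitions using (tri<; tri≈; tri>)
open import Relation.Nullary.Decidable using (True; toWitness; map′; _×-dec_; _⊎-dec_; _→-dec_)
open import Relation.Unary using (Decidable)
open import Function.Bundles using (_⇔_; mk⇔; Equivalence)
open import Function.Construct.Composition using (_⇔-∘_)
open import Function.Base using (_∘_)
open import Function.Construct.Symmetry using (⇔-sym)
open import Function.Definitions using (Injective)
open import Function.Related.Propositional using (equivalence; module EquationalReasoning)
open import Function.Related.TypeIsomorphisms using (¬-cong-⇔)
open import Relation.Binary.PropositionalEquality

open Equivalence using (to; from)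

intersects : ∀ {k} → Subset k → Subset k → Bool
intersects []      []      = false
intersects (a ∷ x) (b ∷ y) = (a ∧ b) ∨ intersects x y

Disjoint : ∀ {k} → Subset k → Subset k → Set
Disjoint x y = intersects x y ≡ false

intersects⇔Meets : ∀ {k} (x y : Subset k) → intersects x y ≡ true ⇔ Meets x y
intersects⇔Meets x y = mk⇔ (sound x y) (complete x y)
  where
  sound : ∀ {k} (x y : Subset k) → intersects x y ≡ true → Meets x y
  sound []          []          ()
  sound (true  ∷ x) (true  ∷ y) _ = fzero , here , here
  sound (true  ∷ x) (false ∷ y) h with i , i∈x , i∈y ← sound x y h = fsuc i , there i∈x , there i∈y
  sound (false ∷ x) (b     ∷ y) h with i , i∈x , i∈y ← sound x y h = fsuc i , there i∈x , there i∈y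
  complete : ∀ {k} (x y : Subset k) → Meets x y → intersects x y ≡ true
  complete (a ∷ x) (b ∷ y) (fzero , here , here) = refl
  complete (a ∷ x) (b ∷ y) (fsuc i , there i∈x , there i∈y)
    rewrite complete x y (i , i∈x , i∈y) = Bool.∨-zeroʳ (a ∧ b)

¬Disjoint⇔Meets : ∀ {k} (x y : Subset k) → (¬ Disjoint x y) ⇔ Meets x y
¬Disjoint⇔Meets x y = intersects⇔Meets x y ⇔-∘ mk⇔ Bool.¬-not Bool.not-¬

-- Adjacency in the n-cycle 0, 1, …, n-1: `Adj n x e` says that e is x or the cyclic
-- predecessor of x.
Adj : ℕ → ℕ → ℕ → Set
Adj n x e = x ≡ e ⊎ x ≡ suc e ⊎ (x ≡ 0 × suc e ≡ n)

-- On a cycle of length at least 3 no two distinct vertices are each other's predecessor,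
-- so adjacency in both directions forces equality.
adj-antisym : ∀ {n a b} → 3 ≤ n → Adj n a b → Adj n b a → a ≡ b
adj-antisym _ (inj₁ a≡b) _          = a≡b
adj-antisym _ _          (inj₁ b≡a) = sym b≡a
adj-antisym {b = b} _ (inj₂ (inj₁ refl)) (inj₂ (inj₁ b≡2+b)) = ⊥-elim (<⇒≢ (s≤s (n≤1+n b)) b≡2+b)
adj-antisym n≥3 (inj₂ (inj₁ refl)) (inj₂ (inj₂ (refl , 2≡n))) = ⊥-elim (<⇒≢ n≥3 2≡n)
adj-antisym n≥3 (inj₂ (inj₂ (refl , 2≡n))) (inj₂ (inj₁ refl)) = ⊥-elim (<⇒≢ n≥3 2≡n)
adj-antisym _ (inj₂ (inj₂ (refl , _))) (inj₂ (inj₂ (refl , _))) = refl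

-- A cycle system of length n over [k] with set size t consists of t-subsets R x and E e
-- (x, e < n) of [k] such that R x and E e are disjoint exactly when e is x or x - 1 (mod n),
-- together with two (t+1)-subsets `first` and `last` which are disjoint from R x exactly for
-- the first vertex x = 0, resp. the last vertex x = n - 1.  The sets R and E are the rows and
-- (shifted) columns of the circulant; `first` and `last` serve to glue two systems.
record CycleSystem (n k t : ℕ) : Set where
  field
    R E         : ℕ → Subset k
    first last  : Subset k
    R-size      : ∀ x → x < n → ∣ R x ∣ ≡ t
    E-size      : ∀ e → e < n → ∣ E e ∣ ≡ t
    first-size  : ∣ first ∣ ≡ suc t
    last-size   : ∣ last ∣ ≡ suc t
    R-E         : ∀ x e → x < n → e < n → Disjoint (R x) (E e) ⇔ Adj n x e
    R-first     : ∀ x → x < n → Disjoint (R x) first ⇔ x ≡ 0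
    R-last      : ∀ x → x < n → Disjoint (R x) last ⇔ suc x ≡ n

  -- Different indices give different sets: if R x = R y then R x avoids E y, the column
  -- avoided by R y, and symmetrically, so x = y (dually for E).  This needs n ≥ 3.
  R-injective : 3 ≤ n → ∀ {x y} → x < n → y < n → R x ≡ R y → x ≡ y
  R-injective n≥3 x<n y<n Rx≡Ry =
    adj-antisym n≥3 (avoids x<n y<n Rx≡Ry) (avoids y<n x<n (sym Rx≡Ry))
    where
    avoids : ∀ {x y} → x < n → y < n → R x ≡ R y → Adj n x y
    avoids {x} {y} x<n y<n Rx≡Ry = to (R-E x y x<n y<n)
      (subst (λ S → Disjoint S (E y)) (sym Rx≡Ry) (from (R-E y y y<n y<n) (inj₁ refl)))

  E-injective : 3 ≤ n → ∀ {e f} → e < n → f < n → E e ≡ E f → e ≡ f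
  E-injective n≥3 e<n f<n Ee≡Ef =
    adj-antisym n≥3 (avoided e<n f<n Ee≡Ef) (avoided f<n e<n (sym Ee≡Ef))
    where
    avoided : ∀ {e f} → e < n → f < n → E e ≡ E f → Adj n e f
    avoided {e} {f} e<n f<n Ee≡Ef = to (R-E e f e<n f<n)
      (subst (Disjoint (R e)) Ee≡Ef (from (R-E e e e<n e<n) (inj₁ refl)))

pad : ∀ {k} m → Subset k → Subset (m + k)
pad zero    x = x
pad (suc m) x = false ∷ pad m x

pad-size : ∀ {k} m (x : Subset k) → ∣ pad m x ∣ ≡ ∣ x ∣
pad-size zero    x = refl
pad-size (suc m) x = pad-size m x

pad-intersects : ∀ {k} m (x y : Subset k) → intersects (pad m x) (pad m y) ≡ intersects x y
pad-intersects zero    x y = refl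
pad-intersects (suc m) x y = pad-intersects m x y

widen : ∀ {n k k' t} → k ≤ k' → CycleSystem n k t → CycleSystem n k' t
widen {n} {k} {k'} {t} k≤k' S = subst (λ K → CycleSystem n K t) (m∸n+n≡m k≤k') padded
  where
  open CycleSystem S
  m : ℕ
  m = k' ∸ k
  disjoint-pad : ∀ {A : Set} x y → Disjoint x y ⇔ A → Disjoint (pad m x) (pad m y) ⇔ A
  disjoint-pad x y h = subst (λ b → (b ≡ false) ⇔ _) (sym (pad-intersects m x y)) h
  padded : CycleSystem n (m + k) t
  padded = record
    { R = λ x → pad m (R x) ; E = λ e → pad m (E e) ; first = pad m first ; last = pad m last
    ; R-size     = λ x x<n → trans (pad-size m (R x)) (R-size x x<n)
    ; E-size     = λ e e<n → trans (pad-size m (E e)) (E-size e e<n)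
    ; first-size = trans (pad-size m first) first-size
    ; last-size  = trans (pad-size m last) last-size
    ; R-E        = λ x e x<n e<n → disjoint-pad (R x) (E e) (R-E x e x<n e<n)
    ; R-first    = λ x x<n → disjoint-pad (R x) first (R-first x x<n)
    ; R-last     = λ x x<n → disjoint-pad (R x) last (R-last x x<n)
    }

-- For n = m + 1 the cycle of length n + n is read as
-- the lower half 0, …, m followed by the upper half n + 0, …, n + m, whose vertex n + y will
-- carry the data of vertex m - y of the original cycle (the second copy runs backwards).
module DoubledCycle (m : ℕ) where
  n N : ℕ
  n = suc m
  N = n + n

  data Half (x : ℕ) : Set where
    lower : x < n → Half x
    upper : ∀ y → y < n → x ≡ n + y → Half x

  half : ∀ x → x < N → Half x
  half x x<N with x <? n
  ... | yes x<n = lower x<n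
  ... | no  x≮n = upper (x ∸ n) (+-cancelˡ-< n _ _ (subst (_< N) (sym n+[x∸n]≡x) x<N)) (sym n+[x∸n]≡x)
    where
    n+[x∸n]≡x : n + (x ∸ n) ≡ x
    n+[x∸n]≡x = m+[n∸m]≡n (≮⇒≥ x≮n)

  -- Columns are split further, since the doubled system puts the end markers `last` and
  -- `first` at the last vertices m and n + m of the two halves.
  data Column (e : ℕ) : Set where
    lower-inner : e < m → Column e
    lower-end   : e ≡ m → Column e
    upper-inner : ∀ a → a < m → e ≡ n + a → Column e
    upper-end   : e ≡ n + m → Column e

  column : ∀ e → e < N → Column e
  column e e<N with half e e<N
  ... | lower e<n with m≤n⇒m<n∨m≡n (≤-pred e<n)
  ...   | inj₁ e<m = lower-inner e<m
  ...   | inj₂ e≡m = lower-end e≡m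
  column e e<N | upper a a<n e≡n+a with m≤n⇒m<n∨m≡n (≤-pred a<n)
  ...   | inj₁ a<m = upper-inner a a<m e≡n+a
  ...   | inj₂ a≡m = upper-end (trans e≡n+a (cong (n +_) a≡m))

  reflect< : ∀ y → m ∸ y < n
  reflect< y = s≤s (m∸n≤m m y)

  reflect≡0 : ∀ {y} → y < n → (m ∸ y ≡ 0) ⇔ (y ≡ m)
  reflect≡0 {y} y<n = mk⇔ (λ m∸y≡0 → trans (sym (cong (_+ y) m∸y≡0)) (m∸n+n≡m (≤-pred y<n)))
                          (λ { refl → n∸n≡0 m })

  adj-lower-inner : ∀ x {e} → e < m → Adj n x e ⇔ Adj N x e
  adj-lower-inner x {e} e<m = mk⇔ widen-adj narrow-adj
    where
    widen-adj : Adj n x e → Adj N x e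
    widen-adj (inj₁ x≡e)                = inj₁ x≡e
    widen-adj (inj₂ (inj₁ x≡1+e))       = inj₂ (inj₁ x≡1+e)
    widen-adj (inj₂ (inj₂ (_ , 1+e≡n))) = ⊥-elim (<⇒≢ e<m (suc-injective 1+e≡n))
    narrow-adj : Adj N x e → Adj n x e
    narrow-adj (inj₁ x≡e)                = inj₁ x≡e
    narrow-adj (inj₂ (inj₁ x≡1+e))       = inj₂ (inj₁ x≡1+e)
    narrow-adj (inj₂ (inj₂ (_ , 1+e≡N))) = ⊥-elim (<⇒≢ (≤-trans (s≤s e<m) (m≤m+n n n)) 1+e≡N)

  adj-lower-end : ∀ {x} → x < n → (suc x ≡ n) ⇔ Adj N x m
  adj-lower-end {x} x<n = mk⇔ (λ 1+x≡n → inj₁ (suc-injective 1+x≡n)) end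
    where
    end : Adj N x m → suc x ≡ n
    end (inj₁ x≡m)              = cong suc x≡m
    end (inj₂ (inj₁ x≡n))       = ⊥-elim (<⇒≢ x<n x≡n)
    end (inj₂ (inj₂ (_ , n≡N))) = ⊥-elim (m≢1+m+n n (trans n≡N (+-suc n m)))

  ¬adj-lower-upper : ∀ {x a} → x < n → a < m → ¬ Adj N x (n + a)
  ¬adj-lower-upper x<n _   (inj₁ x≡n+a)        = <⇒≢ (≤-trans x<n (m≤m+n n _)) x≡n+a
  ¬adj-lower-upper x<n _   (inj₂ (inj₁ x≡1+n+a)) = <⇒≢ (≤-trans x<n (≤-trans (m≤m+n n _) (n≤1+n _))) x≡1+n+a
  ¬adj-lower-upper _   a<m (inj₂ (inj₂ (_ , 1+n+a≡N))) =
    <⇒≢ a<m (suc-injective (+-cancelˡ-≡ n _ _ (trans (+-suc n _) 1+n+a≡N)))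

  adj-lower-top : ∀ {x} → x < n → (x ≡ 0) ⇔ Adj N x (n + m)
  adj-lower-top {x} x<n = mk⇔ (λ x≡0 → inj₂ (inj₂ (x≡0 , sym (+-suc n m)))) top
    where
    top : Adj N x (n + m) → x ≡ 0
    top (inj₁ x≡n+m)        = ⊥-elim (<⇒≢ (≤-trans x<n (m≤m+n n m)) x≡n+m)
    top (inj₂ (inj₁ x≡N))   = ⊥-elim (<⇒≢ (≤-trans x<n (≤-trans (m≤m+n n m) (n≤1+n _))) x≡N)
    top (inj₂ (inj₂ (x≡0 , _))) = x≡0

  ¬adj-upper-lower : ∀ y {e} → e < m → ¬ Adj N (n + y) e
  ¬adj-upper-lower y e<m (inj₁ n+y≡e)        = <⇒≢ (≤-trans e<m (≤-trans (n≤1+n m) (m≤m+n n y))) (sym n+y≡e)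
  ¬adj-upper-lower y e<m (inj₂ (inj₁ n+y≡1+e)) = <⇒≢ (≤-trans (s≤s e<m) (m≤m+n n y)) (sym n+y≡1+e)

  adj-upper-end : ∀ {y} → y < n → (suc (m ∸ y) ≡ n) ⇔ Adj N (n + y) m
  adj-upper-end {y} y<n = mk⇔ start end
    where
    start : suc (m ∸ y) ≡ n → Adj N (n + y) m
    start 1+m∸y≡n = inj₂ (inj₁ (trans (cong (n +_) y≡0) (+-identityʳ n)))
      where
      y≡0 : y ≡ 0
      y≡0 = +-cancelˡ-≡ m _ _ (trans (trans (cong (_+ y) (sym (suc-injective 1+m∸y≡n)))
                                           (m∸n+n≡m (≤-pred y<n))) (sym (+-identityʳ m)))
    end : Adj N (n + y) m → suc (m ∸ y) ≡ n
    end (inj₁ n+y≡m) = ⊥-elim (<⇒≢ (m≤m+n n y) (sym n+y≡m))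
    end (inj₂ (inj₁ n+y≡n)) with +-cancelˡ-≡ n y 0 (trans n+y≡n (sym (+-identityʳ n)))
    ... | refl = refl

  adj-upper-inner : ∀ {y a} → y < n → a < m →
                    Adj n (m ∸ y) (m ∸ suc a) ⇔ Adj N (n + y) (n + a)
  adj-upper-inner {y} {a} y<n a<m = mk⇔ unreflect reflect
    where
    [m∸y]+y≡m : (m ∸ y) + y ≡ m
    [m∸y]+y≡m = m∸n+n≡m (≤-pred y<n)
    [m∸1+a]+1+a≡m : (m ∸ suc a) + suc a ≡ m
    [m∸1+a]+1+a≡m = m∸n+n≡m a<m
    unreflect : Adj n (m ∸ y) (m ∸ suc a) → Adj N (n + y) (n + a)
    unreflect (inj₁ eq) = inj₂ (inj₁ (trans (cong (n +_) y≡1+a) (+-suc n a)))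
      where
      y≡1+a : y ≡ suc a
      y≡1+a = +-cancelˡ-≡ (m ∸ suc a) _ _ (trans (trans (cong (_+ y) (sym eq)) [m∸y]+y≡m) (sym [m∸1+a]+1+a≡m))
    unreflect (inj₂ (inj₁ eq)) = inj₁ (cong (n +_) y≡a)
      where
      y≡a : y ≡ a
      y≡a = +-cancelˡ-≡ (suc (m ∸ suc a)) _ _
              (trans (trans (cong (_+ y) (sym eq)) [m∸y]+y≡m) (trans (sym [m∸1+a]+1+a≡m) (+-suc _ a)))
    unreflect (inj₂ (inj₂ (_ , eq))) =
      ⊥-elim (m≢1+m+n m (trans (sym [m∸1+a]+1+a≡m) (trans (cong (_+ suc a) (suc-injective eq)) (+-suc m a))))
    reflect : Adj N (n + y) (n + a) → Adj n (m ∸ y) (m ∸ suc a)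
    reflect (inj₁ eq) with +-cancelˡ-≡ n y a eq
    ... | refl = inj₂ (inj₁ (+-cancelʳ-≡ y _ _ (trans [m∸y]+y≡m (trans (sym [m∸1+a]+1+a≡m) (+-suc _ y)))))
    reflect (inj₂ (inj₁ eq)) with +-cancelˡ-≡ n y (suc a) (trans eq (sym (+-suc n a)))
    ... | refl = inj₁ (+-cancelʳ-≡ (suc a) _ _ (trans [m∸y]+y≡m (sym [m∸1+a]+1+a≡m)))

  adj-upper-top : ∀ {y} → y < n → (m ∸ y ≡ 0) ⇔ Adj N (n + y) (n + m)
  adj-upper-top {y} y<n = mk⇔ (λ y≡m → inj₁ (cong (n +_) y≡m)) top ⇔-∘ reflect≡0 y<n
    where
    top : Adj N (n + y) (n + m) → y ≡ m
    top (inj₁ eq)        = +-cancelˡ-≡ n y m eq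
    top (inj₂ (inj₁ eq)) = ⊥-elim (<⇒≢ y<n (+-cancelˡ-≡ n y n (trans eq (sym (+-suc n m)))))

  upper-last : ∀ {y} → y < n → (m ∸ y ≡ 0) ⇔ (suc (n + y) ≡ N)
  upper-last {y} y<n = mk⇔ (λ { refl → sym (+-suc n m) })
                           (λ eq → suc-injective (+-cancelˡ-≡ n _ _ (trans (+-suc n y) eq))) ⇔-∘ reflect≡0 y<n

<ᵇ-true : ∀ {a b} → a < b → (a <ᵇ b) ≡ true
<ᵇ-true {zero}  {suc b} _         = refl
<ᵇ-true {suc a} {suc b} (s≤s a<b) = <ᵇ-true a<b

<ᵇ-false : ∀ {a b} → b ≤ a → (a <ᵇ b) ≡ false
<ᵇ-false {a}     {zero}  _         = refl
<ᵇ-false {suc a} {suc b} (s≤s b≤a) = <ᵇ-false b≤a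

never : ∀ {A : Set} → ¬ A → (true ≡ false) ⇔ A
never ¬A = mk⇔ (λ ()) (λ A → contradiction A ¬A)

-- Two copies of a cycle system of length n = m + 1, the second one run
-- backwards, are glued over two new points α (the first coordinate) and β (the second):
--   R' x     = α ∪ R x,          E' e     = β ∪ E e            for x < n and e < m,
--   R' (n+y) = β ∪ R (m - y),    E' (n+a) = α ∪ E (m - 1 - a)  for y < n and a < m,
--   E' m = last,  E' (n+m) = first,  first' = β ∪ first,  last' = α ∪ first.
-- The new points separate the halves, while the old `first`/`last` close the two seams.
module Doubling {m k t : ℕ} (S : CycleSystem (suc m) k t) where
  open CycleSystem S
  open DoubledCycle m

  R' E' : ℕ → Subset (2 + k)
  R' x = if x <ᵇ n then true ∷ false ∷ R x else false ∷ true ∷ R (m ∸ (x ∸ n))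
  E' e = if e <ᵇ m then false ∷ true ∷ E e
         else if e <ᵇ n then false ∷ false ∷ last
         else if (e ∸ n) <ᵇ m then true ∷ false ∷ E (m ∸ suc (e ∸ n))
         else false ∷ false ∷ first

  first' last' : Subset (2 + k)
  first' = false ∷ true ∷ first
  last'  = true ∷ false ∷ first

  R'-lower : ∀ {x} → x < n → R' x ≡ true ∷ false ∷ R x
  R'-lower x<n rewrite <ᵇ-true x<n = refl

  R'-upper : ∀ y → R' (n + y) ≡ false ∷ true ∷ R (m ∸ y)
  R'-upper y rewrite <ᵇ-false {n + y} {n} (m≤m+n n y) | m+n∸m≡n n y = refl

  E'-lower-inner : ∀ {e} → e < m → E' e ≡ false ∷ true ∷ E e
  E'-lower-inner e<m rewrite <ᵇ-true e<m = refl

  E'-lower-end : E' m ≡ false ∷ false ∷ last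
  E'-lower-end rewrite <ᵇ-false {m} {m} ≤-refl | <ᵇ-true {m} {n} ≤-refl = refl

  E'-upper-inner : ∀ {a} → a < m → E' (n + a) ≡ true ∷ false ∷ E (m ∸ suc a)
  E'-upper-inner {a} a<m
    rewrite <ᵇ-false {n + a} {m} (≤-trans (n≤1+n m) (m≤m+n n a))
          | <ᵇ-false {n + a} {n} (m≤m+n n a) | m+n∸m≡n n a | <ᵇ-true a<m = refl

  E'-upper-end : E' (n + m) ≡ false ∷ false ∷ first
  E'-upper-end
    rewrite <ᵇ-false {n + m} {m} (≤-trans (n≤1+n m) (m≤m+n n m))
          | <ᵇ-false {n + m} {n} (m≤m+n n m) | m+n∸m≡n n m | <ᵇ-false {m} {m} ≤-refl = refl

  R'-E' : ∀ x e → x < N → e < N → Disjoint (R' x) (E' e) ⇔ Adj N x e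
  R'-E' x e x<N e<N with half x x<N | column e e<N
  ... | lower x<n | lower-inner e<m rewrite R'-lower x<n | E'-lower-inner e<m =
    adj-lower-inner x e<m ⇔-∘ R-E x e x<n (≤-trans e<m (n≤1+n m))
  ... | lower x<n | lower-end refl rewrite R'-lower x<n | E'-lower-end =
    adj-lower-end x<n ⇔-∘ R-last x x<n
  ... | lower x<n | upper-inner a a<m refl rewrite R'-lower x<n | E'-upper-inner a<m =
    never (¬adj-lower-upper x<n a<m)
  ... | lower x<n | upper-end refl rewrite R'-lower x<n | E'-upper-end =
    adj-lower-top x<n ⇔-∘ R-first x x<n
  ... | upper y _ refl | lower-inner e<m rewrite R'-upper y | E'-lower-inner e<m =
    never (¬adj-upper-lower y e<m)
  ... | upper y y<n refl | lower-end refl rewrite R'-upper y | E'-lower-end =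
    adj-upper-end y<n ⇔-∘ R-last (m ∸ y) (reflect< y)
  ... | upper y y<n refl | upper-inner a a<m refl rewrite R'-upper y | E'-upper-inner a<m =
    adj-upper-inner y<n a<m ⇔-∘ R-E (m ∸ y) (m ∸ suc a) (reflect< y) (reflect< (suc a))
  ... | upper y y<n refl | upper-end refl rewrite R'-upper y | E'-upper-end =
    adj-upper-top y<n ⇔-∘ R-first (m ∸ y) (reflect< y)

  R'-first' : ∀ x → x < N → Disjoint (R' x) first' ⇔ x ≡ 0
  R'-first' x x<N with half x x<N
  ... | lower x<n      rewrite R'-lower x<n = R-first x x<n
  ... | upper y _ refl rewrite R'-upper y   = mk⇔ (λ ()) (λ ())

  R'-last' : ∀ x → x < N → Disjoint (R' x) last' ⇔ suc x ≡ N
  R'-last' x x<N with half x x<N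
  ... | lower x<n        rewrite R'-lower x<n =
    never (λ 1+x≡N → <⇒≢ (≤-trans (s≤s x<n) (s≤s (m≤n+m n m))) 1+x≡N)
  ... | upper y y<n refl rewrite R'-upper y   = upper-last y<n ⇔-∘ R-first (m ∸ y) (reflect< y)

  R'-size : ∀ x → x < N → ∣ R' x ∣ ≡ suc t
  R'-size x x<N with half x x<N
  ... | lower x<n      rewrite R'-lower x<n = cong suc (R-size x x<n)
  ... | upper y _ refl rewrite R'-upper y   = cong suc (R-size (m ∸ y) (reflect< y))

  E'-size : ∀ e → e < N → ∣ E' e ∣ ≡ suc t
  E'-size e e<N with column e e<N
  ... | lower-inner e<m      rewrite E'-lower-inner e<m = cong suc (E-size e (≤-trans e<m (n≤1+n m)))
  ... | lower-end refl       rewrite E'-lower-end       = last-size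
  ... | upper-inner a a<m refl rewrite E'-upper-inner a<m = cong suc (E-size (m ∸ suc a) (reflect< (suc a)))
  ... | upper-end refl       rewrite E'-upper-end       = first-size

  doubled : CycleSystem N (2 + k) (suc t)
  doubled = record
    { R = R' ; E = E' ; first = first' ; last = last'
    ; R-size = R'-size ; E-size = E'-size
    ; first-size = cong suc first-size ; last-size = cong suc first-size
    ; R-E = R'-E' ; R-first = R'-first' ; R-last = R'-last'
    }

double : ∀ {n k t} → 1 ≤ n → CycleSystem n k t → CycleSystem (n + n) (2 + k) (suc t)
double {suc m} _ S = Doubling.doubled S

byDecision : ∀ {P : ℕ → Set} (P? : Decidable P) n → {True (allUpTo? P? n)} → ∀ x → x < n → P x
byDecision P? n {ok} x = toWitness ok

adj? : ∀ n x e → Dec (Adj n x e)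
adj? n x e = x ≟ e ⊎-dec x ≟ suc e ⊎-dec (x ≟ 0 ×-dec suc e ≟ n)

infix 2 _⇔?_
_⇔?_ : ∀ {A B : Set} → Dec A → Dec B → Dec (A ⇔ B)
A? ⇔? B? = map′ (λ (f , g) → mk⇔ f g) (λ A⇔B → to A⇔B , from A⇔B)
                ((A? →-dec B?) ×-dec (B? →-dec A?))

disjoint? : ∀ {k} (x y : Subset k) → Dec (Disjoint x y)
disjoint? x y = intersects x y Bool.≟ false

-- The base case: the 5-cycle over [5] with R x = {x, x+1} and E e = {e+3, e+4} (mod 5),
-- first = {2, 3, 4} and last = {1, 2, 3}.
R₅ : ℕ → Subset 5
R₅ 0 = true  ∷ true  ∷ false ∷ false ∷ false ∷ []
R₅ 1 = false ∷ true  ∷ true  ∷ false ∷ false ∷ []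
R₅ 2 = false ∷ false ∷ true  ∷ true  ∷ false ∷ []
R₅ 3 = false ∷ false ∷ false ∷ true  ∷ true  ∷ []
R₅ 4 = true  ∷ false ∷ false ∷ false ∷ true  ∷ []
R₅ _ = ∅

E₅ : ℕ → Subset 5
E₅ 0 = false ∷ false ∷ false ∷ true  ∷ true  ∷ []
E₅ 1 = true  ∷ false ∷ false ∷ false ∷ true  ∷ []
E₅ 2 = true  ∷ true  ∷ false ∷ false ∷ false ∷ []
E₅ 3 = false ∷ true  ∷ true  ∷ false ∷ false ∷ []
E₅ 4 = false ∷ false ∷ true  ∷ true  ∷ false ∷ []
E₅ _ = ∅

first₅ last₅ : Subset 5
first₅ = false ∷ false ∷ true ∷ true ∷ true  ∷ []
last₅  = false ∷ true  ∷ true ∷ true ∷ false ∷ []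

cycleSystem₅ : CycleSystem 5 5 2
cycleSystem₅ = record
  { R = R₅ ; E = E₅ ; first = first₅ ; last = last₅
  ; R-size     = byDecision (λ x → ∣ R₅ x ∣ ≟ 2) 5
  ; E-size     = byDecision (λ e → ∣ E₅ e ∣ ≟ 2) 5
  ; first-size = refl
  ; last-size  = refl
  ; R-E        = λ x e x<5 e<5 →
      byDecision (λ x → allUpTo? (λ e → disjoint? (R₅ x) (E₅ e) ⇔? adj? 5 x e) 5) 5 x x<5 e<5
  ; R-first    = byDecision (λ x → disjoint? (R₅ x) first₅ ⇔? x ≟ 0) 5
  ; R-last     = byDecision (λ x → disjoint? (R₅ x) last₅ ⇔? suc x ≟ 5) 5
  }

-- The cycle lengths reached from the 5-cycle by doubling: 5 · 2^s = 2^(s+2) + 2^s.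
cycleLength : ℕ → ℕ
cycleLength s = 2 ^ (2 + s) + 2 ^ s

cycleLength-suc : ∀ s → cycleLength (suc s) ≡ cycleLength s + cycleLength s
cycleLength-suc s = twice (2 ^ s)
  where
  twice : ∀ a → 2 * (2 * (2 * a)) + 2 * a ≡ (2 * (2 * a) + a) + (2 * (2 * a) + a)
  twice = solve-∀

cycleLength-≥4 : ∀ s → 4 ≤ cycleLength s
cycleLength-≥4 s = ≤-trans (^-monoʳ-≤ 2 (m≤m+n 2 s)) (m≤m+n (2 ^ (2 + s)) (2 ^ s))

cycleSystem : ∀ s → ∃ λ k → CycleSystem (cycleLength s) k (2 + s)
cycleSystem zero    = 5 , cycleSystem₅
cycleSystem (suc s) with k , S ← cycleSystem s =
  2 + k , subst (λ n → CycleSystem n (2 + k) (3 + s)) (sym (cycleLength-suc s))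
                (double (≤-trans (s≤s z≤n) (cycleLength-≥4 s)) S)

-- Column j of C p 2 is matched with the vertex j - 2 (mod p + 2) of the cycle.
shift₂ : ℕ → ℕ → ℕ
shift₂ p zero          = p
shift₂ p (suc zero)    = suc p
shift₂ p (suc (suc j)) = j

shift₂-< : ∀ p {j} → j < 2 + p → shift₂ p j < 2 + p
shift₂-< p {zero}          _   = s≤s (n≤1+n p)
shift₂-< p {suc zero}      _   = ≤-refl
shift₂-< p {suc (suc j)}   j<n = ≤-trans (n≤1+n _) (≤-trans (n≤1+n _) j<n)

shift₂-injective : ∀ p {j j'} → j < 2 + p → j' < 2 + p → shift₂ p j ≡ shift₂ p j' → j ≡ j'
shift₂-injective p {zero}        {zero}         _   _    _  = refl
shift₂-injective p {zero}        {suc zero}     _   _    eq = ⊥-elim (1+n≢n (sym eq))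
shift₂-injective p {zero}        {suc (suc j')} _   j'<n eq = ⊥-elim (<⇒≢ (≤-pred (≤-pred j'<n)) (sym eq))
shift₂-injective p {suc zero}    {zero}         _   _    eq = ⊥-elim (1+n≢n eq)
shift₂-injective p {suc zero}    {suc zero}     _   _    _  = refl
shift₂-injective p {suc zero}    {suc (suc j')} _   j'<n eq =
  ⊥-elim (<⇒≢ (≤-trans (≤-pred (≤-pred j'<n)) (n≤1+n p)) (sym eq))
shift₂-injective p {suc (suc j)} {zero}         j<n _    eq = ⊥-elim (<⇒≢ (≤-pred (≤-pred j<n)) eq)
shift₂-injective p {suc (suc j)} {suc zero}     j<n _    eq =
  ⊥-elim (<⇒≢ (≤-trans (≤-pred (≤-pred j<n)) (n≤1+n p)) eq)
shift₂-injective p {suc (suc j)} {suc (suc j')} _   _    eq = cong (suc ∘ suc) eq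

residue : ℕ → ℕ → ℕ → ℕ
residue p x j = ((x + (2 + p)) ∸ j) % (2 + p)

-- The statement writes n as p + 2; as 2 + p it is a successor, so `modN` computes.
C≡residue<ᵇ : ∀ p x j → (modN ((x + (p + 2)) ∸ j) (p + 2) <ᵇ p) ≡ (residue p x j <ᵇ p)
C≡residue<ᵇ p x j rewrite +-comm p 2 = refl

wrap : ∀ p {d} → d < 2 + p → (d + (2 + p)) % (2 + p) ≡ d
wrap p {d} d<n = trans ([m+n]%n≡m%n d (2 + p)) (m<n⇒m%n≡m d<n)

residue-below : ∀ {A : Set} {r v p} → r ≡ v → v < p → A → Reflects A (r <ᵇ p)
residue-below refl v<p a rewrite <ᵇ-true v<p = ofʸ a

residue-above : ∀ {A : Set} {r v p} → r ≡ v → p ≤ v → ¬ A → Reflects A (r <ᵇ p)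
residue-above refl p≤v ¬a rewrite <ᵇ-false p≤v = ofⁿ ¬a

entry-column0 : ∀ p {x} → x < 2 + p → Reflects (¬ Adj (2 + p) x p) (residue p x 0 <ᵇ p)
entry-column0 p {x} x<n with <-cmp x p
... | tri< x<p _ _ = residue-below (wrap p x<n) x<p ¬adj
  where
  ¬adj : ¬ Adj (2 + p) x p
  ¬adj (inj₁ x≡p)               = <⇒≢ x<p x≡p
  ¬adj (inj₂ (inj₁ x≡1+p))      = <⇒≢ (≤-trans x<p (n≤1+n p)) x≡1+p
  ¬adj (inj₂ (inj₂ (_ , 1+p≡n))) = 1+n≢n (sym 1+p≡n)
... | tri≈ _ refl _ = residue-above (wrap p x<n) ≤-refl (contradiction (inj₁ refl))
... | tri> _ _ p<x with ≤-antisym (≤-pred x<n) p<x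
...   | refl = residue-above (wrap p x<n) (n≤1+n p) (contradiction (inj₂ (inj₁ refl)))

entry-column1 : ∀ p {x} → x < 2 + p → Reflects (¬ Adj (2 + p) x (suc p)) (residue p x 1 <ᵇ p)
entry-column1 p {zero}  _   =
  residue-above (m<n⇒m%n≡m (n<1+n (suc p))) (n≤1+n p) (contradiction (inj₂ (inj₂ (refl , refl))))
entry-column1 p {suc x} x<n with <-cmp x p
... | tri< x<p _ _ = residue-below (wrap p (≤-trans (n≤1+n _) x<n)) x<p ¬adj
  where
  ¬adj : ¬ Adj (2 + p) (suc x) (suc p)
  ¬adj (inj₁ 1+x≡1+p)        = <⇒≢ x<p (suc-injective 1+x≡1+p)
  ¬adj (inj₂ (inj₁ 1+x≡2+p)) = <⇒≢ (≤-trans x<p (n≤1+n p)) (suc-injective 1+x≡2+p)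
... | tri≈ _ refl _ =
  residue-above (wrap p (≤-trans (n≤1+n _) x<n)) ≤-refl (contradiction (inj₁ refl))
... | tri> _ _ p<x = ⊥-elim (<⇒≱ p<x (≤-pred (≤-pred x<n)))

difference₂ : ∀ p x j → (x + (2 + p)) ∸ (2 + j) ≡ (x + p) ∸ j
difference₂ p x j rewrite +-suc x (suc p) | +-suc x p = refl

-- Column 2 + j with j = x + 1 + o ahead of x: the difference wraps around to p - (1 + o),
-- a one of the row.
entry-ahead : ∀ p x o → suc x + o < p →
              Reflects (¬ Adj (2 + p) x (suc x + o)) (residue p x (2 + (suc x + o)) <ᵇ p)
entry-ahead p x o j<p = residue-below residue≡ value<p ¬adj
  where
  j : ℕ
  j = suc x + o
  residue≡ : residue p x (2 + j) ≡ p ∸ suc o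
  residue≡ = begin
    ((x + (2 + p)) ∸ (2 + j)) % (2 + p)  ≡⟨ cong (_% (2 + p)) (difference₂ p x j) ⟩
    ((x + p) ∸ (suc x + o)) % (2 + p)    ≡⟨ cong (λ i → ((x + p) ∸ i) % (2 + p)) (sym (+-suc x o)) ⟩
    ((x + p) ∸ (x + suc o)) % (2 + p)    ≡⟨ cong (_% (2 + p)) ([m+n]∸[m+o]≡n∸o x p (suc o)) ⟩
    (p ∸ suc o) % (2 + p)                ≡⟨ m<n⇒m%n≡m (≤-trans (s≤s (m∸n≤m p (suc o))) (n≤1+n _)) ⟩
    p ∸ suc o                            ∎
    where open ≡-Reasoning
  value<p : p ∸ suc o < p
  value<p = ∸-monoʳ-< (s≤s z≤n) (≤-trans (s≤s (m≤n+m o x)) (<⇒≤ j<p))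
  x<j : x < j
  x<j = s≤s (m≤m+n x o)
  ¬adj : ¬ Adj (2 + p) x j
  ¬adj (inj₁ x≡j)                = <⇒≢ x<j x≡j
  ¬adj (inj₂ (inj₁ x≡1+j))       = <⇒≢ (≤-trans x<j (n≤1+n _)) x≡1+j
  ¬adj (inj₂ (inj₂ (_ , 1+j≡n))) = <⇒≢ (≤-trans j<p (n≤1+n p)) (suc-injective 1+j≡n)

residue-behind : ∀ p j o → residue p (j + o) (2 + j) ≡ (o + p) % (2 + p)
residue-behind p j o = begin
  ((j + o + (2 + p)) ∸ (2 + j)) % (2 + p)  ≡⟨ cong (_% (2 + p)) (difference₂ p (j + o) j) ⟩
  ((j + o + p) ∸ j) % (2 + p)              ≡⟨ cong (λ i → (i ∸ j) % (2 + p)) (+-assoc j o p) ⟩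
  ((j + (o + p)) ∸ j) % (2 + p)            ≡⟨ cong (_% (2 + p)) (m+n∸m≡n j (o + p)) ⟩
  (o + p) % (2 + p)                        ∎
  where open ≡-Reasoning

-- Column 2 + j with x = j + o behind j: the difference is o + p, a zero of the row exactly
-- for o ∈ {0, 1}, i.e. for x ∈ {j, j + 1}.
entry-behind : ∀ p j o → j + o < 2 + p →
               Reflects (¬ Adj (2 + p) (j + o) j) (residue p (j + o) (2 + j) <ᵇ p)
entry-behind p j zero _ =
  residue-above {v = p} (trans (residue-behind p j 0) (m<n⇒m%n≡m (s≤s (n≤1+n p))))
                ≤-refl (contradiction (inj₁ (+-identityʳ j)))
entry-behind p j (suc zero) _ =
  residue-above {v = suc p} (trans (residue-behind p j 1) (m<n⇒m%n≡m ≤-refl)) (n≤1+n p)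
                (contradiction (inj₂ (inj₁ (+-comm j 1))))
entry-behind p j (suc (suc d)) x<n =
  residue-below (trans (residue-behind p j (2 + d)) wrapped) d<p ¬adj
  where
  d<p : d < p
  d<p = ≤-pred (≤-pred (≤-trans (s≤s (m≤n+m (2 + d) j)) x<n))
  wrapped : (2 + d + p) % (2 + p) ≡ d
  wrapped = trans (cong (_% (2 + p)) (sym (trans (+-suc d (suc p)) (cong suc (+-suc d p)))))
                  (wrap p (≤-trans d<p (≤-trans (n≤1+n p) (n≤1+n _))))
  ¬adj : ¬ Adj (2 + p) (j + suc (suc d)) j
  ¬adj (inj₁ eq)              = m+1+n≢m j eq
  ¬adj (inj₂ (inj₁ eq))       = m+1+n≢m j (suc-injective (trans (sym (+-suc j (suc d))) eq))
  ¬adj (inj₂ (inj₂ (eq , _))) = m+1+n≢0 j eq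

entry-column2+ : ∀ p {x j} → x < 2 + p → j < p →
                 Reflects (¬ Adj (2 + p) x j) (residue p x (2 + j) <ᵇ p)
entry-column2+ p {x} {j} x<n j<p with x <? j
... | yes x<j with o , refl ← m≤n⇒∃[o]m+o≡n x<j          = entry-ahead p x o j<p
... | no  x≮j with o , refl ← m≤n⇒∃[o]m+o≡n (≮⇒≥ x≮j) = entry-behind p j o x<n

circulant-entry : ∀ p {x j} → x < 2 + p → j < 2 + p →
                  Reflects (¬ Adj (2 + p) x (shift₂ p j)) (residue p x j <ᵇ p)
circulant-entry p {j = zero}        x<n _   = entry-column0 p x<n
circulant-entry p {j = suc zero}    x<n _   = entry-column1 p x<n
circulant-entry p {j = suc (suc j)} x<n j<n = entry-column2+ p x<n (≤-pred (≤-pred j<n))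

reflects⇔ : ∀ {A : Set} {b} → Reflects A b → (b ≡ true) ⇔ A
reflects⇔ (ofʸ a)  = mk⇔ (λ _ → a) (λ _ → refl)
reflects⇔ (ofⁿ ¬a) = mk⇔ (λ ()) (λ a → contradiction a ¬a)

circulant-submatrix : ∀ {n k t} → 3 ≤ n → CycleSystem n k t → IsSubmatrixOfA k t (C (n ∸ 2) 2)
circulant-submatrix {suc (suc p)} {k} n≥3 S =
  F , G , F-injective , G-injective ,
  (λ i → R-size (toℕ i) (bound i)) ,
  (λ j → E-size (shift₂ p (toℕ j)) (shift₂-< p (bound j))) ,
  entries
  where
  open CycleSystem S
  bound : (i : Fin (p + 2)) → toℕ i < 2 + p
  bound i = subst (toℕ i <_) (+-comm p 2) (toℕ<n i)
  F G : Fin (p + 2) → Subset k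
  F i = R (toℕ i)
  G j = E (shift₂ p (toℕ j))
  F-injective : Injective _≡_ _≡_ F
  F-injective {i} {i'} = toℕ-injective ∘ R-injective n≥3 (bound i) (bound i')
  G-injective : Injective _≡_ _≡_ G
  G-injective {j} {j'} = toℕ-injective ∘ shift₂-injective p (bound j) (bound j')
                         ∘ E-injective n≥3 (shift₂-< p (bound j)) (shift₂-< p (bound j'))
  entries : ∀ i j → (C p 2 i j ≡ true) ⇔ Meets (F i) (G j)
  entries i j = begin
    C p 2 i j ≡ true                        ∼⟨ mk⇔ (trans (sym C≡bit)) (trans C≡bit) ⟩
    (residue p x y <ᵇ p) ≡ true             ∼⟨ reflects⇔ (circulant-entry p (bound i) (bound j)) ⟩
    ¬ Adj (2 + p) x (shift₂ p y)            ∼⟨ ¬-cong-⇔ (⇔-sym (R-E x _ (bound i) (shift₂-< p (bound j))))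
                                             ⟩
    ¬ Disjoint (F i) (G j)                  ∼⟨ ¬Disjoint⇔Meets (F i) (G j) ⟩
    Meets (F i) (G j)                       ∎
    where
    open EquationalReasoning {k = equivalence}
    x y : ℕ
    x = toℕ i
    y = toℕ j
    C≡bit : C p 2 i j ≡ (residue p x y <ᵇ p)
    C≡bit = C≡residue<ᵇ p x y
circulant-submatrix {suc zero} (s≤s ())

-- For t = s + 2 the cycle system of stage s has length 2^t + 2^(t-2) = p + 2, so it realises
-- C_{p,2} inside A_{k,t} for its k, and widening the ground set gives every larger k.
theorem4 : (t : ℕ) → 2 < t →
    ∃ λ (k₀ : ℕ) → (k : ℕ) → k ≥ k₀ →
    IsSubmatrixOfA k t (C ((2 ^ t + 2 ^ (t ∸ 2)) ∸ 2) 2)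
theorem4 (suc (suc s)) _ with k₀ , S ← cycleSystem s =
  k₀ , λ k k≥k₀ → circulant-submatrix (≤-trans (n≤1+n 3) (cycleLength-≥4 s)) (widen k≥k₀ S)
theorem4 (suc zero) (s≤s ())
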